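{- Let $Q$ be the output of the sampling procedure below with positive integer parameter $t$. Then every edge $e\in E$ satisfies $\Pr[e\in Q]\ge\min\!\big(1/3,\ t x_e/3\big)$.
   Context: $G=(V,E)$ is a finite graph with nonnegative edge weights and probabilities $p_e\in(0,1]$; the realization $\mathcal{G}$ contains each edge $e$ independently with probability $p_e$. $\mu(\cdot)$ is a fixed deterministic algorithm returning a maximum-weight matching of a given graph, $\mathrm{OPT}=\mu(\mathcal{G})$ and $x_e=\Pr[e\in\mathrm{OPT}]$. Sampling procedure with parameter $t$: for $i=1,\dots,t$, draw independently a random subgraph $G_i$ of $G$ containing each edge $e$ independently with probability $p_e$, let $M_i=\mu(G_i)$; output $Q=\bigcup_{i=1}^t M_i$.
   Formalization: The edge weights and the probabilities $p_e$ are rational. -}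

module Defs where

open import Data.Bool using (Bool; true; false; if_then_else_)
open import Data.Nat using (ℕ; zero; suc)
open import Data.Integer using (+_)
open import Data.Fin using (Fin)
open import Data.Fin.Subset using (Subset; _∈_; _⊆_; _∪_; ⊥)
open import Data.Vec using (Vec; []; _∷_; lookup)
import Data.Vec as V
open import Data.List using (List; []; _∷_; map; concatMap; foldr; allFin)
open import Data.Product using (_×_; proj₁; proj₂; ∃)
open import Data.Sum using (_⊎_)
open import Data.Rational using (ℚ; 0ℚ; 1ℚ; _+_; _*_; _-_; _≤_; _<_; _/_)
open import Relation.Binary.PropositionalEquality using (_≡_)
open import Relation.Nullary using (¬_)

record Graph : Set where
  field
    n        : ℕ
    m        : ℕ
    ends     : Fin m → Fin n × Fin n
    loopless : ∀ e → ¬ (proj₁ (ends e) ≡ proj₂ (ends e))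
    simple   : ∀ e f → (ends e ≡ ends f
                        ⊎ (proj₁ (ends e) ≡ proj₂ (ends f) × proj₂ (ends e) ≡ proj₁ (ends f)))
                      → e ≡ f

open Graph public

-- Subgraphs of G (on the same vertex set) are identified with edge subsets.
EdgeSet : Graph → Set
EdgeSet G = Subset (m G)

_incident_ : {G : Graph} → Fin (n G) → Fin (m G) → Set
_incident_ {G} v e = v ≡ proj₁ (ends G e) ⊎ v ≡ proj₂ (ends G e)

IsMatching : (G : Graph) → EdgeSet G → Set
IsMatching G M = ∀ e f → e ∈ M → f ∈ M → ¬ (e ≡ f) →
                 ¬ (∃ λ (v : Fin (n G)) → _incident_ {G} v e × _incident_ {G} v f)

Σℚ : {A : Set} → List A → (A → ℚ) → ℚ
Σℚ xs f = foldr (λ a acc → f a + acc) 0ℚ xs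

Πℚ : {A : Set} → List A → (A → ℚ) → ℚ
Πℚ xs f = foldr (λ a acc → f a * acc) 1ℚ xs

ind : Bool → ℚ
ind b = if b then 1ℚ else 0ℚ

weight : (G : Graph) → (Fin (m G) → ℚ) → EdgeSet G → ℚ
weight G w M = Σℚ (allFin (m G)) (λ e → ind (lookup M e) * w e)

IsMaxWeightMatching : (G : Graph) → (Fin (m G) → ℚ) → EdgeSet G → EdgeSet G → Set
IsMaxWeightMatching G w H M =
  M ⊆ H × IsMatching G M ×
  (∀ M' → M' ⊆ H → IsMatching G M' → weight G w M' ≤ weight G w M)

allSubsets : (k : ℕ) → List (Subset k)
allSubsets zero    = [] ∷ []
allSubsets (suc k) = concatMap (λ s → (true ∷ s) ∷ (false ∷ s) ∷ []) (allSubsets k)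

allTuples : (k t : ℕ) → List (Vec (Subset k) t)
allTuples k zero    = [] ∷ []
allTuples k (suc t) =
  concatMap (λ s → map (λ ss → s ∷ ss) (allTuples k t)) (allSubsets k)

-- probability that the random subgraph (each e present independently w.p. p e)
-- equals exactly S
probRealization : (G : Graph) → (Fin (m G) → ℚ) → EdgeSet G → ℚ
probRealization G p S =
  Πℚ (allFin (m G)) (λ e → if lookup S e then p e else 1ℚ - p e)

-- x_e = Pr[e ∈ OPT], OPT = μ(𝒢)
xProb : (G : Graph) → (Fin (m G) → ℚ) → (EdgeSet G → EdgeSet G) → Fin (m G) → ℚ
xProb G p μ e =
  Σℚ (allSubsets (m G)) (λ S → probRealization G p S * ind (lookup (μ S) e))

-- output Q = ⋃ᵢ μ(Gᵢ) of the sampling procedure on samples G₁ … G_t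
sampleOutput : (G : Graph) → (EdgeSet G → EdgeSet G) → {t : ℕ} → Vec (EdgeSet G) t → EdgeSet G
sampleOutput G μ Gs = V.foldr _ (λ S acc → μ S ∪ acc) ⊥ Gs

-- Pr[e ∈ Q] with G₁ … G_t independent realizations
probInQ : (G : Graph) → (Fin (m G) → ℚ) → (EdgeSet G → EdgeSet G) → ℕ → Fin (m G) → ℚ
probInQ G p μ t e =
  Σℚ (allTuples (m G) t)
     (λ Gs → Πℚ (V.toList Gs) (probRealization G p)
             * ind (lookup (sampleOutput G μ Gs) e))

ℕtoℚ : ℕ → ℚ
ℕtoℚ k = + k / 1

{-# OPTIONS --safe #-}
-- Pr[e ∈ Q] after t samples is a_t = 1 − (1 − x_e)^t, and conditioning on the
-- first sample gives a_{t+1} = x + (1 − x) a_t.  For 0 ≤ c ≤ 1/2, the lower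
-- bound c ⊓ t x c then survives each step by induction: x + (1 − x) a exceeds
-- b + x c whenever b ≤ a and b ≤ c ≤ 1 − c.

module Submission where

open import Defs
open import Data.Nat using (ℕ; _≥_)
open import Data.Fin using (Fin)
open import Data.Rational using (ℚ; 0ℚ; 1ℚ; _≤_; _<_; _*_; _⊓_; _/_)
open import Data.Integer using (+_)

import Data.Nat as ℕ
import Data.Nat.Properties as ℕ
open import Data.Nat.Divisibility using (∣1⇒≡1)
open import Data.Fin using (zero; suc)
open import Data.Bool using (Bool; true; false; if_then_else_; _∨_)
open import Data.List using (List; []; _∷_; _++_; map; concatMap; tabulate; allFin)
open import Data.Vec using (Vec; lookup) renaming (_∷_ to _∷ᵥ_)
import Data.Vec as Vec
open import Data.Vec.Properties using (lookup-replicate; lookup-zipWith)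
open import Data.Fin.Subset using (Subset; _∪_)
open import Data.Product using (proj₂)
open import Function using (_∘_)
open import Data.Rational using (mkℚ; _+_; _-_; -_; nonNegative)
open import Data.Rational.Properties
open import Data.Rational.Solver using (module +-*-Solver)
open +-*-Solver
open import Relation.Nullary.Decidable using (from-yes)
open import Relation.Binary.PropositionalEquality

0≤p⇒0≤q⇒0≤p+q : ∀ {p q} → 0ℚ ≤ p → 0ℚ ≤ q → 0ℚ ≤ p + q
0≤p⇒0≤q⇒0≤p+q {p} {q} 0≤p 0≤q =
  nonNegative⁻¹ _ {{nonNeg+nonNeg⇒nonNeg p {{nonNegative 0≤p}} q {{nonNegative 0≤q}}}}

0≤p⇒0≤q⇒0≤p*q : ∀ {p q} → 0ℚ ≤ p → 0ℚ ≤ q → 0ℚ ≤ p * q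
0≤p⇒0≤q⇒0≤p*q {p} {q} 0≤p 0≤q =
  nonNegative⁻¹ _ {{nonNeg*nonNeg⇒nonNeg p {{nonNegative 0≤p}} q {{nonNegative 0≤q}}}}

p≤q⇒0≤q-p : ∀ {p q} → p ≤ q → 0ℚ ≤ q - p
p≤q⇒0≤q-p {p} {q} p≤q = subst (_≤ q - p) (+-inverseʳ p) (+-monoˡ-≤ (- p) p≤q)

0≤q⇒p≤p+q : ∀ {p q} → 0ℚ ≤ q → p ≤ p + q
0≤q⇒p≤p+q {p} 0≤q = subst (_≤ p + _) (+-identityʳ p) (+-monoʳ-≤ p 0≤q)

ℕtoℚ-suc : ∀ k → ℕtoℚ (ℕ.suc k) ≡ 1ℚ + ℕtoℚ k
ℕtoℚ-suc ℕ.zero    = refl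
-- 1ℚ + mkℚ (+ n) 0 _ computes to the unnormalised fraction + (1 + n * 1) / 1.
ℕtoℚ-suc (ℕ.suc j) = sym (begin
  1ℚ + ℕtoℚ (ℕ.suc j)                ≡⟨ cong (_+_ 1ℚ) (↥p/↧p≡p (mkℚ (+ ℕ.suc j) 0 (∣1⇒≡1 ∘ proj₂))) ⟩
  + ℕ.suc (ℕ.suc (j ℕ.* 1)) / 1      ≡⟨ cong (λ i → + ℕ.suc (ℕ.suc i) / 1) (ℕ.*-identityʳ j) ⟩
  ℕtoℚ (ℕ.suc (ℕ.suc j))             ∎)
  where open ≡-Reasoning

module _ {A : Set} where

  Σℚ-cong : ∀ (xs : List A) {f g : A → ℚ} → (∀ a → f a ≡ g a) → Σℚ xs f ≡ Σℚ xs g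
  Σℚ-cong []       f≡g = refl
  Σℚ-cong (x ∷ xs) f≡g = cong₂ _+_ (f≡g x) (Σℚ-cong xs f≡g)

  Σℚ-++ : ∀ (xs ys : List A) f → Σℚ (xs ++ ys) f ≡ Σℚ xs f + Σℚ ys f
  Σℚ-++ []       ys f = sym (+-identityˡ _)
  Σℚ-++ (x ∷ xs) ys f = trans (cong (_+_ (f x)) (Σℚ-++ xs ys f)) (sym (+-assoc (f x) _ _))

  Σℚ-*ˡ : ∀ (xs : List A) c f → Σℚ xs (λ a → c * f a) ≡ c * Σℚ xs f
  Σℚ-*ˡ []       c f = sym (*-zeroʳ c)
  Σℚ-*ˡ (x ∷ xs) c f = trans (cong (_+_ (c * f x)) (Σℚ-*ˡ xs c f)) (sym (*-distribˡ-+ c (f x) _))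

  Σℚ-linear : ∀ (xs : List A) c d f g →
              Σℚ xs (λ a → c * f a + d * g a) ≡ c * Σℚ xs f + d * Σℚ xs g
  Σℚ-linear []       c d f g = solve 2 (λ c d → con 0ℚ := c :* con 0ℚ :+ d :* con 0ℚ) refl c d
  Σℚ-linear (x ∷ xs) c d f g = trans (cong (_+_ (c * f x + d * g x)) (Σℚ-linear xs c d f g))
    (solve 6 (λ c d u v U V → c :* u :+ d :* v :+ (c :* U :+ d :* V)
                            := c :* (u :+ U) :+ d :* (v :+ V))
           refl c d (f x) (g x) (Σℚ xs f) (Σℚ xs g))

  Σℚ-mono : ∀ (xs : List A) {f g : A → ℚ} → (∀ a → f a ≤ g a) → Σℚ xs f ≤ Σℚ xs g
  Σℚ-mono []       f≤g = ≤-refl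
  Σℚ-mono (x ∷ xs) f≤g = +-mono-≤ (f≤g x) (Σℚ-mono xs f≤g)

  Σℚ-nonneg : ∀ (xs : List A) {f : A → ℚ} → (∀ a → 0ℚ ≤ f a) → 0ℚ ≤ Σℚ xs f
  Σℚ-nonneg []       0≤f = ≤-refl
  Σℚ-nonneg (x ∷ xs) 0≤f = 0≤p⇒0≤q⇒0≤p+q (0≤f x) (Σℚ-nonneg xs 0≤f)

  Πℚ-nonneg : ∀ (xs : List A) {f : A → ℚ} → (∀ a → 0ℚ ≤ f a) → 0ℚ ≤ Πℚ xs f
  Πℚ-nonneg []       0≤f = nonNegative⁻¹ 1ℚ
  Πℚ-nonneg (x ∷ xs) 0≤f = 0≤p⇒0≤q⇒0≤p*q (0≤f x) (Πℚ-nonneg xs 0≤f)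

Σℚ-concatMap : ∀ {A B : Set} (g : A → List B) (xs : List A) f →
               Σℚ (concatMap g xs) f ≡ Σℚ xs (λ a → Σℚ (g a) f)
Σℚ-concatMap g []       f = refl
Σℚ-concatMap g (x ∷ xs) f =
  trans (Σℚ-++ (g x) (concatMap g xs) f) (cong (_+_ (Σℚ (g x) f)) (Σℚ-concatMap g xs f))

Σℚ-map : ∀ {A B : Set} (h : A → B) (xs : List A) f → Σℚ (map h xs) f ≡ Σℚ xs (f ∘ h)
Σℚ-map h []       f = refl
Σℚ-map h (x ∷ xs) f = cong (_+_ (f (h x))) (Σℚ-map h xs f)

Πℚ-tabulate : ∀ {A : Set} n (h : Fin n → A) f → Πℚ (tabulate h) f ≡ Πℚ (allFin n) (f ∘ h)
Πℚ-tabulate ℕ.zero    h f = refl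
Πℚ-tabulate (ℕ.suc n) h f = cong (f (h zero) *_)
  (trans (Πℚ-tabulate n (h ∘ suc) f) (sym (Πℚ-tabulate n suc (f ∘ h))))

ind-nonneg : ∀ b → 0ℚ ≤ ind b
ind-nonneg true  = nonNegative⁻¹ 1ℚ
ind-nonneg false = ≤-refl

ind≤1 : ∀ b → ind b ≤ 1ℚ
ind≤1 true  = ≤-refl
ind≤1 false = nonNegative⁻¹ 1ℚ

ind-∨ : ∀ a b → ind (a ∨ b) ≡ ind a + (1ℚ - ind a) * ind b
ind-∨ true  b = solve 1 (λ y → con 1ℚ := con 1ℚ :+ (con 1ℚ :- con 1ℚ) :* y) refl (ind b)
ind-∨ false b = solve 1 (λ y → y := con 0ℚ :+ (con 1ℚ :- con 0ℚ) :* y) refl (ind b)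

Pr : {A : Set} → List A → (A → ℚ) → (A → Bool) → ℚ
Pr xs P f = Σℚ xs (λ a → P a * ind (f a))

module _ {A : Set} (xs : List A) {P : A → ℚ} (P-nonneg : ∀ a → 0ℚ ≤ P a) (f : A → Bool) where

  Pr-nonneg : 0ℚ ≤ Pr xs P f
  Pr-nonneg = Σℚ-nonneg xs (λ a → 0≤p⇒0≤q⇒0≤p*q (P-nonneg a) (ind-nonneg (f a)))

  Pr≤1 : Σℚ xs P ≡ 1ℚ → Pr xs P f ≤ 1ℚ
  Pr≤1 P-total = subst (Pr xs P f ≤_) P-total (Σℚ-mono xs P*ind≤P)
    where
    P*ind≤P : ∀ a → P a * ind (f a) ≤ P a
    P*ind≤P a = subst (P a * ind (f a) ≤_) (*-identityʳ (P a))
      (*-monoˡ-≤-nonNeg (P a) {{nonNegative (P-nonneg a)}} (ind≤1 (f a)))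

Pr-∨-independent : ∀ {A B : Set} (xs : List A) (ys : List B) {P : A → ℚ} {Q : B → ℚ} f g →
  Σℚ xs P ≡ 1ℚ → Σℚ ys Q ≡ 1ℚ →
  Σℚ xs (λ a → Σℚ ys (λ b → (P a * Q b) * ind (f a ∨ g b)))
    ≡ Pr xs P f + (1ℚ - Pr xs P f) * Pr ys Q g
Pr-∨-independent xs ys {P} {Q} f g P-total Q-total = begin
  Σℚ xs (λ a → Σℚ ys (λ b → (P a * Q b) * ind (f a ∨ g b)))
    ≡⟨ Σℚ-cong xs inner ⟩
  Σℚ xs (λ a → (1ℚ - β) * (P a * ind (f a)) + β * P a)
    ≡⟨ Σℚ-linear xs (1ℚ - β) β (λ a → P a * ind (f a)) P ⟩
  (1ℚ - β) * α + β * Σℚ xs P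
    ≡⟨ cong (λ s → (1ℚ - β) * α + β * s) P-total ⟩
  (1ℚ - β) * α + β * 1ℚ
    ≡⟨ solve 2 (λ α β → (con 1ℚ :- β) :* α :+ β :* con 1ℚ
                      := α :+ (con 1ℚ :- α) :* β) refl α β ⟩
  α + (1ℚ - α) * β ∎
  where
  open ≡-Reasoning
  α β : ℚ
  α = Pr xs P f
  β = Pr ys Q g
  inner : ∀ a → Σℚ ys (λ b → (P a * Q b) * ind (f a ∨ g b))
              ≡ (1ℚ - β) * (P a * ind (f a)) + β * P a
  inner a = begin
    Σℚ ys (λ b → (P a * Q b) * ind (f a ∨ g b))
      ≡⟨ Σℚ-cong ys (λ b → cong ((P a * Q b) *_) (ind-∨ (f a) (g b))) ⟩
    Σℚ ys (λ b → (P a * Q b) * (i + (1ℚ - i) * ind (g b)))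
      ≡⟨ Σℚ-cong ys (λ b → solve 4 (λ π q i j → (π :* q) :* (i :+ (con 1ℚ :- i) :* j)
                                             := (π :* i) :* q :+ (π :* (con 1ℚ :- i)) :* (q :* j))
                                    refl (P a) (Q b) i (ind (g b))) ⟩
    Σℚ ys (λ b → (P a * i) * Q b + (P a * (1ℚ - i)) * (Q b * ind (g b)))
      ≡⟨ Σℚ-linear ys (P a * i) (P a * (1ℚ - i)) Q (λ b → Q b * ind (g b)) ⟩
    (P a * i) * Σℚ ys Q + (P a * (1ℚ - i)) * β
      ≡⟨ cong (λ s → (P a * i) * s + (P a * (1ℚ - i)) * β) Q-total ⟩
    (P a * i) * 1ℚ + (P a * (1ℚ - i)) * β
      ≡⟨ solve 3 (λ π i β → (π :* i) :* con 1ℚ :+ (π :* (con 1ℚ :- i)) :* β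
                          := (con 1ℚ :- β) :* (π :* i) :+ β :* π) refl (P a) i β ⟩
    (1ℚ - β) * (P a * i) + β * P a ∎
    where
    i : ℚ
    i = ind (f a)

productMeasure : ∀ {k} → (Fin k → ℚ) → Subset k → ℚ
productMeasure {k} q S = Πℚ (allFin k) (λ i → if lookup S i then q i else 1ℚ - q i)

productMeasure-∷ : ∀ {k} (q : Fin (ℕ.suc k) → ℚ) b S →
  productMeasure q (b ∷ᵥ S) ≡ (if b then q zero else 1ℚ - q zero) * productMeasure (q ∘ suc) S
productMeasure-∷ {k} q b S = cong ((if b then q zero else 1ℚ - q zero) *_)
  (Πℚ-tabulate k suc (λ i → if lookup (b ∷ᵥ S) i then q i else 1ℚ - q i))

productMeasure-total : ∀ {k} (q : Fin k → ℚ) → Σℚ (allSubsets k) (productMeasure q) ≡ 1ℚ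
productMeasure-total {ℕ.zero}  q = refl
productMeasure-total {ℕ.suc k} q = begin
  Σℚ (allSubsets (ℕ.suc k)) (productMeasure q)
    ≡⟨ Σℚ-concatMap (λ S → (true ∷ᵥ S) ∷ (false ∷ᵥ S) ∷ []) (allSubsets k) (productMeasure q) ⟩
  Σℚ (allSubsets k) (λ S → productMeasure q (true ∷ᵥ S) + (productMeasure q (false ∷ᵥ S) + 0ℚ))
    ≡⟨ Σℚ-cong (allSubsets k) both-values ⟩
  Σℚ (allSubsets k) (productMeasure (q ∘ suc))
    ≡⟨ productMeasure-total (q ∘ suc) ⟩
  1ℚ ∎
  where
  open ≡-Reasoning
  both-values : ∀ S → productMeasure q (true ∷ᵥ S) + (productMeasure q (false ∷ᵥ S) + 0ℚ)
                    ≡ productMeasure (q ∘ suc) S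
  both-values S rewrite productMeasure-∷ q true S | productMeasure-∷ q false S =
    solve 2 (λ r π → r :* π :+ ((con 1ℚ :- r) :* π :+ con 0ℚ) := π) refl
          (q zero) (productMeasure (q ∘ suc) S)

productMeasure-nonneg : ∀ {k} {q : Fin k → ℚ} → (∀ i → 0ℚ ≤ q i) → (∀ i → q i ≤ 1ℚ) →
                        ∀ S → 0ℚ ≤ productMeasure q S
productMeasure-nonneg {k} {q} 0≤q q≤1 S = Πℚ-nonneg (allFin k) factor-nonneg
  where
  factor-nonneg : ∀ i → 0ℚ ≤ (if lookup S i then q i else 1ℚ - q i)
  factor-nonneg i with lookup S i
  ... | true  = 0≤q i
  ... | false = p≤q⇒0≤q-p (q≤1 i)

tupleMeasure : ∀ {k t} → (Subset k → ℚ) → Vec (Subset k) t → ℚ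
tupleMeasure P Ss = Πℚ (Vec.toList Ss) P

Σℚ-allTuples-suc : ∀ k t (F : Vec (Subset k) (ℕ.suc t) → ℚ) →
  Σℚ (allTuples k (ℕ.suc t)) F ≡ Σℚ (allSubsets k) (λ S → Σℚ (allTuples k t) (λ Ss → F (S ∷ᵥ Ss)))
Σℚ-allTuples-suc k t F =
  trans (Σℚ-concatMap (λ S → map (S ∷ᵥ_) (allTuples k t)) (allSubsets k) F)
        (Σℚ-cong (allSubsets k) (λ S → Σℚ-map (S ∷ᵥ_) (allTuples k t) F))

tupleMeasure-total : ∀ {k} {P : Subset k → ℚ} → Σℚ (allSubsets k) P ≡ 1ℚ →
                     ∀ t → Σℚ (allTuples k t) (tupleMeasure P) ≡ 1ℚ
tupleMeasure-total         P-total ℕ.zero    = refl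
tupleMeasure-total {k} {P} P-total (ℕ.suc t) = begin
  Σℚ (allTuples k (ℕ.suc t)) (tupleMeasure P)
    ≡⟨ Σℚ-allTuples-suc k t (tupleMeasure P) ⟩
  Σℚ (allSubsets k) (λ S → Σℚ (allTuples k t) (λ Ss → P S * tupleMeasure P Ss))
    ≡⟨ Σℚ-cong (allSubsets k) (λ S → Σℚ-*ˡ (allTuples k t) (P S) (tupleMeasure P)) ⟩
  Σℚ (allSubsets k) (λ S → P S * Σℚ (allTuples k t) (tupleMeasure P))
    ≡⟨ Σℚ-cong (allSubsets k) (λ S → trans (cong (P S *_) (tupleMeasure-total {P = P} P-total t))
                                           (*-identityʳ (P S))) ⟩
  Σℚ (allSubsets k) P
    ≡⟨ P-total ⟩
  1ℚ ∎
  where open ≡-Reasoning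

module _ (G : Graph) (p : Fin (m G) → ℚ) (μ : EdgeSet G → EdgeSet G) (e : Fin (m G)) where

  probInQ-zero : probInQ G p μ 0 e ≡ 0ℚ
  probInQ-zero rewrite lookup-replicate e false = refl

  probInQ-suc : ∀ t → probInQ G p μ (ℕ.suc t) e
                    ≡ xProb G p μ e + (1ℚ - xProb G p μ e) * probInQ G p μ t e
  probInQ-suc t = begin
    probInQ G p μ (ℕ.suc t) e
      ≡⟨ Σℚ-allTuples-suc (m G) t (λ Gs → tupleMeasure P Gs * ind (lookup (Q Gs) e)) ⟩
    Σℚ (allSubsets (m G)) (λ S → Σℚ (allTuples (m G) t) (λ Ss →
      (P S * tupleMeasure P Ss) * ind (lookup (μ S ∪ Q Ss) e)))
      ≡⟨ Σℚ-cong (allSubsets (m G)) (λ S → Σℚ-cong (allTuples (m G) t) (λ Ss →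
           cong (λ b → (P S * tupleMeasure P Ss) * ind b) (lookup-zipWith _∨_ e (μ S) (Q Ss)))) ⟩
    Σℚ (allSubsets (m G)) (λ S → Σℚ (allTuples (m G) t) (λ Ss →
      (P S * tupleMeasure P Ss) * ind (lookup (μ S) e ∨ lookup (Q Ss) e)))
      ≡⟨ Pr-∨-independent (allSubsets (m G)) (allTuples (m G) t) {P} {tupleMeasure P}
           (λ S → lookup (μ S) e) (λ Ss → lookup (Q Ss) e)
           (productMeasure-total p) (tupleMeasure-total {P = P} (productMeasure-total p) t) ⟩
    xProb G p μ e + (1ℚ - xProb G p μ e) * probInQ G p μ t e ∎
    where
    open ≡-Reasoning
    P : EdgeSet G → ℚ
    P = productMeasure p
    Q : ∀ {t} → Vec (EdgeSet G) t → EdgeSet G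
    Q = sampleOutput G μ

module _ {c x : ℚ} (0≤c : 0ℚ ≤ c) (c+c≤1 : c + c ≤ 1ℚ) (0≤x : 0ℚ ≤ x) (x≤1 : x ≤ 1ℚ) where

  bound-step : ∀ {b a} → b ≤ c → b ≤ a → b + x * c ≤ x + (1ℚ - x) * a
  bound-step {b} {a} b≤c b≤a = subst (b + x * c ≤_) (sym split) (0≤q⇒p≤p+q slack-nonneg)
    where
    slack : ℚ
    slack = (a - b) * (1ℚ - x) + x * ((1ℚ - (c + c)) + (c - b))
    split : x + (1ℚ - x) * a ≡ b + x * c + slack
    split = solve 4 (λ x a b c → x :+ (con 1ℚ :- x) :* a
                             := b :+ x :* c :+ ((a :- b) :* (con 1ℚ :- x)
                                               :+ x :* ((con 1ℚ :- (c :+ c)) :+ (c :- b))))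
                  refl x a b c
    slack-nonneg : 0ℚ ≤ slack
    slack-nonneg = 0≤p⇒0≤q⇒0≤p+q
      (0≤p⇒0≤q⇒0≤p*q (p≤q⇒0≤q-p b≤a) (p≤q⇒0≤q-p x≤1))
      (0≤p⇒0≤q⇒0≤p*q 0≤x (0≤p⇒0≤q⇒0≤p+q (p≤q⇒0≤q-p c+c≤1) (p≤q⇒0≤q-p b≤c)))

  capped-linear-suc : ∀ t → c ⊓ (ℕtoℚ (ℕ.suc t) * x * c) ≤ c ⊓ (ℕtoℚ t * x * c) + x * c
  capped-linear-suc t = begin
    c ⊓ (ℕtoℚ (ℕ.suc t) * x * c)
      ≡⟨ cong (λ n → c ⊓ (n * x * c)) (ℕtoℚ-suc t) ⟩
    c ⊓ ((1ℚ + ℕtoℚ t) * x * c)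
      ≡⟨ cong (c ⊓_) (solve 3 (λ n x c → (con 1ℚ :+ n) :* x :* c := n :* x :* c :+ x :* c)
                              refl (ℕtoℚ t) x c) ⟩
    c ⊓ (ℕtoℚ t * x * c + x * c)
      ≤⟨ ⊓-monoˡ-≤ _ (0≤q⇒p≤p+q {c} (0≤p⇒0≤q⇒0≤p*q 0≤x 0≤c)) ⟩
    (c + x * c) ⊓ (ℕtoℚ t * x * c + x * c)
      ≡⟨ mono-≤-distrib-⊓ (+-monoˡ-≤ (x * c)) c (ℕtoℚ t * x * c) ⟨
    c ⊓ (ℕtoℚ t * x * c) + x * c ∎
    where open ≤-Reasoning

  repeated-trials-bound : (a : ℕ → ℚ) → a 0 ≡ 0ℚ → (∀ t → a (ℕ.suc t) ≡ x + (1ℚ - x) * a t) →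
                          ∀ t → c ⊓ (ℕtoℚ t * x * c) ≤ a t
  repeated-trials-bound a a₀ a-suc ℕ.zero = begin
    c ⊓ (0ℚ * x * c) ≤⟨ p⊓q≤q c _ ⟩
    0ℚ * x * c       ≡⟨ trans (cong (_* c) (*-zeroˡ x)) (*-zeroˡ c) ⟩
    0ℚ               ≡⟨ a₀ ⟨
    a 0              ∎
    where open ≤-Reasoning
  repeated-trials-bound a a₀ a-suc (ℕ.suc t) = begin
    c ⊓ (ℕtoℚ (ℕ.suc t) * x * c) ≤⟨ capped-linear-suc t ⟩
    c ⊓ (ℕtoℚ t * x * c) + x * c ≤⟨ bound-step (p⊓q≤p c _) (repeated-trials-bound a a₀ a-suc t) ⟩
    x + (1ℚ - x) * a t           ≡⟨ a-suc t ⟨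
    a (ℕ.suc t)                  ∎
    where open ≤-Reasoning

claim4p2 : (G : Graph)
    (w : Fin (m G) → ℚ) → (∀ e → 0ℚ ≤ w e) →
    (p : Fin (m G) → ℚ) → (∀ e → 0ℚ < p e) → (∀ e → p e ≤ 1ℚ) →
    (μ : EdgeSet G → EdgeSet G) → (∀ H → IsMaxWeightMatching G w H (μ H)) →
    (t : ℕ) → t ≥ 1 →
    (e : Fin (m G)) →
    ((+ 1 / 3) ⊓ (ℕtoℚ t * xProb G p μ e * (+ 1 / 3))) ≤ probInQ G p μ t e
claim4p2 G _ _ p 0<p p≤1 μ _ t _ e =
  repeated-trials-bound (nonNegative⁻¹ _) (from-yes (+ 1 / 3 + + 1 / 3 ≤? 1ℚ)) 0≤x x≤1
    (λ s → probInQ G p μ s e) (probInQ-zero G p μ e) (probInQ-suc G p μ e) t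
  where
  P-nonneg : ∀ S → 0ℚ ≤ productMeasure p S
  P-nonneg = productMeasure-nonneg (λ i → <⇒≤ (0<p i)) p≤1
  0≤x : 0ℚ ≤ xProb G p μ e
  0≤x = Pr-nonneg (allSubsets (m G)) P-nonneg (λ S → lookup (μ S) e)
  x≤1 : xProb G p μ e ≤ 1ℚ
  x≤1 = Pr≤1 (allSubsets (m G)) P-nonneg (λ S → lookup (μ S) e) (productMeasure-total p)
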